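{- Let $n$ be a positive integer and let $w_1 \leq \dots \leq w_m$ be a feasible partition of $n$. Then for every $i$ with $1 \leq i \leq m$, $R_i \geq \frac{3w_i - 1}{2}$.
   Context: A feasible partition of a positive integer $n$ is a nondecreasing sequence of positive integers $w_1 \leq \dots \leq w_m$ with $w_1 + \dots + w_m = n$ such that (i) every integer $k$ with $1 \leq k \leq n$ can be written as $k = \sum_{i=1}^m u_i w_i$ with each $u_i \in \{ -1,0,1\}$, and (ii) $m$ is the minimum possible number of parts among all sequences of positive integers summing to $n$ with property (i). For such a partition, $R_i = w_1 + \dots + w_i$ for $1 \leq i \leq m$, and $R_0 = 0$. -}

module Defs where

open import Data.Nat using (ℕ; _≤_; _<_)
open import Data.Integer as ℤ using (ℤ; +_; -_)
open import Data.List using (List; []; _∷_; length)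
open import Data.Nat.ListAction using (sum)
open import Data.List.Relation.Unary.All using (All)
open import Data.List.Relation.Unary.Linked using (Linked)
open import Data.Product using (Σ; _×_)
open import Relation.Binary.PropositionalEquality using (_≡_)

data Sign : Set where
  neg zer pos : Sign

⟦_⟧ : Sign → ℤ
⟦ neg ⟧ = - (+ 1)
⟦ zer ⟧ = + 0
⟦ pos ⟧ = + 1

signedSum : List Sign → List ℕ → ℤ
signedSum (u ∷ us) (w ∷ ws) = ⟦ u ⟧ ℤ.* (+ w) ℤ.+ signedSum us ws
signedSum _ _ = + 0

Representable : List ℕ → ℕ → Set
Representable ws k = Σ (List Sign) λ us → (length us ≡ length ws) × (signedSum us ws ≡ + k)

Complete : ℕ → List ℕ → Set
Complete n ws = ∀ k → 1 ≤ k → k ≤ n → Representable ws k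

Admissible : ℕ → List ℕ → Set
Admissible n ws = All (λ w → 0 < w) ws × (sum ws ≡ n) × Complete n ws

Feasible : ℕ → List ℕ → Set
Feasible n ws = Linked _≤_ ws × Admissible n ws
              × (∀ vs → Admissible n vs → length ws ≤ length vs)

-- For a representation k = Σ u_i w_i, the deficit n − k = Σ (1 − u_i) w_i is a sum of
-- contributions 0, w_j or 2 w_j. Let r = R_{i−1} and represent k = n − (2r + 1). The weights
-- before w_i contribute at most 2r to the deficit 2r + 1, so some weight w_j ≥ w_i (j ≥ i)
-- contributes, giving w_i ≤ 2r + 1, i.e. 3 w_i ≤ 2 R_i + 1.
module Submission where

open import Defs
open import Data.Nat using (ℕ; suc; _+_; _*_; _∸_; _≤_; _<_; z≤n; z<s; _≤?_)
open import Data.Nat.Properties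
open import Data.Nat.ListAction using (sum)
open import Data.Nat.ListAction.Properties using (sum-++)
open import Data.Integer as ℤ using (+_; -_)
import Data.Integer.Properties as ℤ
open import Data.Fin using (Fin; zero; suc; toℕ)
open import Data.List using (List; []; _∷_; _++_; length; lookup; take; drop)
open import Data.List.Properties using (take-suc)
open import Data.List.Relation.Unary.All using (All; []; _∷_)
open import Data.List.Relation.Unary.Linked using (Linked; []; [-]; _∷_)
open import Data.List.Relation.Unary.Linked.Properties using (Linked⇒All)
open import Data.Product using (Σ; _,_; proj₁; proj₂)
open import Data.Sum using (_⊎_; inj₁; inj₂)
open import Relation.Nullary using (yes; no; contradiction)
open import Relation.Binary.Core using (Rel)
open import Relation.Binary.Definitions using (Transitive)
open import Relation.Binary.PropositionalEquality
import Data.Integer.Tactic.RingSolver as ℤ-Solver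
import Data.Nat.Tactic.RingSolver as ℕ-Solver

deficit : Sign → ℕ → ℕ
deficit neg w = w + w
deficit zer w = w
deficit pos w = 0

totalDeficit : List Sign → List ℕ → ℕ
totalDeficit (u ∷ us) (w ∷ ws) = deficit u w + totalDeficit us ws
totalDeficit _        _        = 0

sign*w+deficit≡w : ∀ u w → ⟦ u ⟧ ℤ.* + w ℤ.+ + deficit u w ≡ + w
sign*w+deficit≡w neg w = trans (cong (λ d → ⟦ neg ⟧ ℤ.* + w ℤ.+ d) (ℤ.pos-+ w w)) (cancel (+ w))
  where
  cancel : ∀ x → - (+ 1) ℤ.* x ℤ.+ (x ℤ.+ x) ≡ x
  cancel = ℤ-Solver.solve-∀
sign*w+deficit≡w zer w = refl
sign*w+deficit≡w pos w = trans (ℤ.+-identityʳ _) (ℤ.*-identityˡ (+ w))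

signedSum+totalDeficit≡sum : ∀ us ws → length us ≡ length ws →
  signedSum us ws ℤ.+ + totalDeficit us ws ≡ + sum ws
signedSum+totalDeficit≡sum []       []       _  = refl
signedSum+totalDeficit≡sum (u ∷ us) (w ∷ ws) eq = begin
  (⟦ u ⟧ ℤ.* + w ℤ.+ signedSum us ws) ℤ.+ + (deficit u w + totalDeficit us ws)
    ≡⟨ cong (λ d → ⟦ u ⟧ ℤ.* + w ℤ.+ signedSum us ws ℤ.+ d) (ℤ.pos-+ (deficit u w) (totalDeficit us ws)) ⟩
  (⟦ u ⟧ ℤ.* + w ℤ.+ signedSum us ws) ℤ.+ (+ deficit u w ℤ.+ + totalDeficit us ws)
    ≡⟨ interchange (⟦ u ⟧ ℤ.* + w) (signedSum us ws) (+ deficit u w) (+ totalDeficit us ws) ⟩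
  (⟦ u ⟧ ℤ.* + w ℤ.+ + deficit u w) ℤ.+ (signedSum us ws ℤ.+ + totalDeficit us ws)
    ≡⟨ cong₂ ℤ._+_ (sign*w+deficit≡w u w) (signedSum+totalDeficit≡sum us ws (suc-injective eq)) ⟩
  + w ℤ.+ + sum ws
    ≡⟨ ℤ.pos-+ w (sum ws) ⟨
  + (w + sum ws) ∎
  where
  open ≡-Reasoning
  interchange : ∀ a b c d → (a ℤ.+ b) ℤ.+ (c ℤ.+ d) ≡ (a ℤ.+ c) ℤ.+ (b ℤ.+ d)
  interchange = ℤ-Solver.solve-∀

Representable⇒deficit : ∀ {ws k} → Representable ws k →
  Σ (List Sign) λ us → k + totalDeficit us ws ≡ sum ws
Representable⇒deficit {ws} {k} (us , length≡ , signedSum≡k) = us , ℤ.+-injective (begin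
  + (k + totalDeficit us ws)          ≡⟨ ℤ.pos-+ k (totalDeficit us ws) ⟩
  + k ℤ.+ + totalDeficit us ws        ≡⟨ cong (λ s → s ℤ.+ + totalDeficit us ws) signedSum≡k ⟨
  signedSum us ws ℤ.+ + totalDeficit us ws ≡⟨ signedSum+totalDeficit≡sum us ws length≡ ⟩
  + sum ws                            ∎)
  where open ≡-Reasoning

totalDeficit-++ : ∀ us xs ys → totalDeficit us (xs ++ ys) ≡
  totalDeficit (take (length xs) us) xs + totalDeficit (drop (length xs) us) ys
totalDeficit-++ us       []       ys = refl
totalDeficit-++ []       (x ∷ xs) ys = refl
totalDeficit-++ (u ∷ us) (x ∷ xs) ys =
  trans (cong (_+_ (deficit u x)) (totalDeficit-++ us xs ys)) (sym (+-assoc (deficit u x) _ _))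

deficit≤2*w : ∀ u w → deficit u w ≤ 2 * w
deficit≤2*w neg w = ≤-reflexive (cong (_+_ w) (sym (+-identityʳ w)))
deficit≤2*w zer w = m≤m+n w (w + 0)
deficit≤2*w pos w = z≤n

totalDeficit≤2*sum : ∀ us ws → totalDeficit us ws ≤ 2 * sum ws
totalDeficit≤2*sum []       ws       = z≤n
totalDeficit≤2*sum (u ∷ us) []       = z≤n
totalDeficit≤2*sum (u ∷ us) (w ∷ ws) = ≤-trans
  (+-mono-≤ (deficit≤2*w u w) (totalDeficit≤2*sum us ws))
  (≤-reflexive (sym (*-distribˡ-+ 2 w (sum ws))))

totalDeficit≡0⊎≥ : ∀ {b} us ws → All (b ≤_) ws → totalDeficit us ws ≡ 0 ⊎ b ≤ totalDeficit us ws
totalDeficit≡0⊎≥ []         ws       _            = inj₁ refl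
totalDeficit≡0⊎≥ (u ∷ us)   []       _            = inj₁ refl
totalDeficit≡0⊎≥ (pos ∷ us) (w ∷ ws) (_   ∷ b≤ws) = totalDeficit≡0⊎≥ us ws b≤ws
totalDeficit≡0⊎≥ (zer ∷ us) (w ∷ ws) (b≤w ∷ _)    = inj₂ (≤-trans b≤w (m≤m+n w _))
totalDeficit≡0⊎≥ (neg ∷ us) (w ∷ ws) (b≤w ∷ _)    =
  inj₂ (≤-trans b≤w (≤-trans (m≤m+n w w) (m≤m+n (w + w) _)))

-- The prefix xs can account for at most 2·sum xs of the deficit; the rest is 0 or ≥ b.
lowerBound≤totalDeficit : ∀ {b} us xs ys → All (b ≤_) ys →
  2 * sum xs < totalDeficit us (xs ++ ys) → b ≤ totalDeficit us (xs ++ ys)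
lowerBound≤totalDeficit us xs ys b≤ys 2xs<D
  rewrite totalDeficit-++ us xs ys
  with totalDeficit≡0⊎≥ (drop (length xs) us) ys b≤ys
... | inj₁ ys≡0 = contradiction (totalDeficit≤2*sum (take (length xs) us) xs)
  (<⇒≱ (subst (2 * sum xs <_) (trans (cong (_+_ _) ys≡0) (+-identityʳ _)) 2xs<D))
... | inj₂ b≤ys = ≤-trans b≤ys (m≤n+m _ _)

w≤sum[xs++w∷ys] : ∀ xs w ys → w ≤ sum (xs ++ w ∷ ys)
w≤sum[xs++w∷ys] xs w ys = ≤-trans (m≤m+n w (sum ys))
  (≤-trans (m≤n+m _ (sum xs)) (≤-reflexive (sym (sum-++ xs (w ∷ ys)))))

weight≤2*prefix+1 : ∀ xs w ys → All (w ≤_) ys →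
  Complete (sum (xs ++ w ∷ ys)) (xs ++ w ∷ ys) → w ≤ 2 * sum xs + 1
weight≤2*prefix+1 xs w ys w≤ys complete with sum (xs ++ w ∷ ys) ≤? 2 * sum xs + 1
... | yes n≤c = ≤-trans (w≤sum[xs++w∷ys] xs w ys) n≤c
... | no  n≰c = subst (w ≤_) D≡c
  (lowerBound≤totalDeficit us xs (w ∷ ys) (≤-refl ∷ w≤ys) (subst (2 * sum xs <_) (sym D≡c) (m<m+n _ z<s)))
  where
  n c k : ℕ
  n = sum (xs ++ w ∷ ys)
  c = 2 * sum xs + 1
  k = n ∸ c
  c<n : c < n
  c<n = ≰⇒> n≰c
  deficitRepresentation : Σ (List Sign) λ us → k + totalDeficit us (xs ++ w ∷ ys) ≡ n
  deficitRepresentation = Representable⇒deficit (complete k (m<n⇒0<n∸m c<n) (m∸n≤m n c))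
  us : List Sign
  us = proj₁ deficitRepresentation
  D≡c : totalDeficit us (xs ++ w ∷ ys) ≡ c
  D≡c = +-cancelˡ-≡ k _ c (trans (proj₂ deficitRepresentation) (sym (m∸n+n≡m (<⇒≤ c<n))))

take++lookup∷drop : ∀ {a} {A : Set a} (xs : List A) (i : Fin (length xs)) →
  xs ≡ take (toℕ i) xs ++ lookup xs i ∷ drop (suc (toℕ i)) xs
take++lookup∷drop (x ∷ xs) zero    = refl
take++lookup∷drop (x ∷ xs) (suc i) = cong (x ∷_) (take++lookup∷drop xs i)

Linked⇒All-lookup-drop : ∀ {a ℓ} {A : Set a} {R : Rel A ℓ} → Transitive R →
  ∀ xs (i : Fin (length xs)) → Linked R xs → All (R (lookup xs i)) (drop (suc (toℕ i)) xs)
Linked⇒All-lookup-drop R-trans (x ∷ [])     zero    [-]       = []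
Linked⇒All-lookup-drop R-trans (x ∷ y ∷ xs) zero    (Rxy ∷ l) = Linked⇒All R-trans Rxy l
Linked⇒All-lookup-drop R-trans (x ∷ y ∷ xs) (suc i) (_ ∷ l)   = Linked⇒All-lookup-drop R-trans (y ∷ xs) i l

lookup≤2*sum-take+1 : ∀ ws → Linked _≤_ ws → Complete (sum ws) ws →
  (i : Fin (length ws)) → lookup ws i ≤ 2 * sum (take (toℕ i) ws) + 1
lookup≤2*sum-take+1 ws sorted complete i = weight≤2*prefix+1 _ _ _
  (Linked⇒All-lookup-drop ≤-trans ws i sorted)
  (subst (λ xs → Complete (sum xs) xs) (take++lookup∷drop ws i) complete)

sum-take-suc : ∀ ws (i : Fin (length ws)) →
  sum (take (suc (toℕ i)) ws) ≡ sum (take (toℕ i) ws) + lookup ws i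
sum-take-suc ws i = begin
  sum (take (suc (toℕ i)) ws)                    ≡⟨ cong sum (take-suc ws i) ⟩
  sum (take (toℕ i) ws ++ lookup ws i ∷ [])      ≡⟨ sum-++ (take (toℕ i) ws) _ ⟩
  sum (take (toℕ i) ws) + (lookup ws i + 0)      ≡⟨ cong (_+_ (sum (take (toℕ i) ws))) (+-identityʳ _) ⟩
  sum (take (toℕ i) ws) + lookup ws i            ∎
  where open ≡-Reasoning

3*w≤2*[r+w]+1 : ∀ r w → w ≤ 2 * r + 1 → 3 * w ≤ 2 * (r + w) + 1
3*w≤2*[r+w]+1 r w w≤2r+1 = begin
  3 * w               ≡⟨ +-comm w (2 * w) ⟩
  2 * w + w           ≤⟨ +-monoʳ-≤ (2 * w) w≤2r+1 ⟩
  2 * w + (2 * r + 1) ≡⟨ regroup r w ⟩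
  2 * (r + w) + 1     ∎
  where
  open ≤-Reasoning
  regroup : ∀ r w → 2 * w + (2 * r + 1) ≡ 2 * (r + w) + 1
  regroup = ℕ-Solver.solve-∀

mainTheorem3 : (n : ℕ) → 0 < n → (ws : List ℕ) → Feasible n ws →
    (i : Fin (length ws)) →
    3 * lookup ws i ≤ 2 * sum (take (suc (toℕ i)) ws) + 1
mainTheorem3 _ _ ws (sorted , (_ , refl , complete) , _) i =
  subst (λ s → 3 * lookup ws i ≤ 2 * s + 1) (sym (sum-take-suc ws i))
    (3*w≤2*[r+w]+1 (sum (take (toℕ i) ws)) (lookup ws i) (lookup≤2*sum-take+1 ws sorted complete i))
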